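{- Let $G$ be a connected graph on $n$ vertices, let $B=\{v_1,\dots,v_b\}$ with $b\ge1$ be the set of blue vertices, and let $p\in(0,1)$ be the reversion probability. Then the expected number of blue vertices in $G$ after one step of the SARPZF color change rule is at most $(1-p)(b+b^2)$.
   Context: The SARPZF color change rule with reversion probability $p$: Phase 1: each blue vertex $u$ independently attempts to force (color blue) each white neighbor $w$ with success probability $|N[u]\cap B|/\deg u$ ($N[u]$ closed neighborhood); a white vertex becomes blue if some attempt succeeds, giving $B'$. Phase 2: each vertex of $B'$ independently turns white with probability $p$. Graphs are finite and simple.
   Formalization: The reversion probability $p$ takes only rational values in the interval (0,1). -}

module Defs where

open import Data.Bool using (Bool; true; false; if_then_else_; _∨_; _∧_; not)
open import Data.Nat as ℕ using (ℕ; zero; suc)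
open import Data.Fin using (Fin; zero; suc)
open import Data.Fin.Properties using (_≟_)
open import Data.List using (List; []; _∷_; map; concatMap; filterᵇ; foldr; length)
open import Data.List using (allFin)
open import Data.Vec using (Vec; []; _∷_; lookup)
open import Data.Product using (_×_; _,_)
open import Data.Integer using (+_)
open import Data.Rational using (ℚ; _/_; 0ℚ; 1ℚ; _+_; _*_; _-_)
open import Relation.Nullary.Decidable using (⌊_⌋)
open import Relation.Binary.PropositionalEquality using (_≡_)
open import Relation.Binary.Construct.Closure.ReflexiveTransitive using (Star)

record Graph (n : ℕ) : Set where
  field
    adj   : Fin n → Fin n → Bool
    sym   : ∀ u v → adj u v ≡ adj v u
    irrefl : ∀ u → adj u u ≡ false

open Graph public

Edge : ∀ {n} → Graph n → Fin n → Fin n → Set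
Edge G u v = adj G u v ≡ true

Connected : ∀ {n} → Graph n → Set
Connected {n} G = ∀ (u v : Fin n) → Star (Edge G) u v

count : ∀ {n} → (Fin n → Bool) → ℕ
count {n} P = length (filterᵇ P (allFin n))

deg : ∀ {n} → Graph n → Fin n → ℕ
deg G u = count (adj G u)

closedNbr : ∀ {n} → Graph n → Fin n → Fin n → Bool
closedNbr G u v = ⌊ u ≟ v ⌋ ∨ adj G u v

blueClosedNbrs : ∀ {n} → Graph n → (Fin n → Bool) → Fin n → ℕ
blueClosedNbrs G B u = count (λ v → closedNbr G u v ∧ B v)

ℕtoℚ : ℕ → ℚ
ℕtoℚ k = + k / 1

-- k / d as a rational (d = 0 never occurs in use: a blue vertex forcing a
-- white neighbour has degree ≥ 1; we set it to 0 for totality)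
ratio : ℕ → ℕ → ℚ
ratio k zero    = 0ℚ
ratio k (suc d) = + k / suc d

forceProb : ∀ {n} → Graph n → (Fin n → Bool) → Fin n → ℚ
forceProb G B u = ratio (blueClosedNbrs G B u) (deg G u)

Dist : Set → Set
Dist A = List (A × ℚ)

return : ∀ {A : Set} → A → Dist A
return x = (x , 1ℚ) ∷ []

_>>=_ : ∀ {A B : Set} → Dist A → (A → Dist B) → Dist B
d >>= f = concatMap (λ { (a , p) → map (λ { (b , q) → (b , p * q) }) (f a) }) d

bernoulli : ℚ → Dist Bool
bernoulli q = (true , q) ∷ (false , 1ℚ - q) ∷ []

expect : ∀ {A : Set} → Dist A → (A → ℚ) → ℚ
expect d f = foldr (λ { (a , p) acc → p * f a + acc }) 0ℚ d

anySuccess : List ℚ → Dist Bool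
anySuccess []       = return false
anySuccess (q ∷ qs) = bernoulli q >>= λ s → anySuccess qs >>= λ t → return (s ∨ t)

independent : ∀ {n} → (Fin n → Dist Bool) → Dist (Vec Bool n)
independent {zero}  f = return []
independent {suc n} f =
  f zero >>= λ x → independent (λ i → f (suc i)) >>= λ xs → return (x ∷ xs)

-- Phase 1: every blue vertex u independently attempts to force each white
-- neighbour w with probability |N[u] ∩ B| / deg u.
phase1 : ∀ {n} → Graph n → (Fin n → Bool) → Dist (Vec Bool n)
phase1 {n} G B = independent λ w →
  if B w then return true
  else anySuccess (map (forceProb G B)
                       (filterᵇ (λ u → B u ∧ adj G u w) (allFin n)))

phase2 : ∀ {n} → ℚ → Vec Bool n → Dist (Vec Bool n)
phase2 p B' = independent λ v →
  if lookup B' v then (bernoulli p >>= λ r → return (not r)) else return false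

sarpzfStep : ∀ {n} → Graph n → (Fin n → Bool) → ℚ → Dist (Vec Bool n)
sarpzfStep G B p = phase1 G B >>= phase2 p

expectedBlue : ∀ {n} → Graph n → (Fin n → Bool) → ℚ → ℚ
expectedBlue {n} G B p = expect (sarpzfStep G B p) (λ c → ℕtoℚ (count (lookup c)))

module Submission where

-- Phase 2 keeps each vertex of B′ blue with probability 1 − p, so by linearity the expected
-- final count is (1 − p)·E|B′|.  In phase 1 blue vertices stay blue, and by the union bound
-- a white vertex w turns blue with probability at most the sum of |N[u] ∩ B| / deg u over
-- its blue neighbours u.  Exchanging the two sums, a blue vertex u contributes
-- (number of white neighbours of u)·|N[u] ∩ B| / deg u ≤ |N[u] ∩ B| ≤ b, hence
-- E|B′| ≤ b + b².  The union bound needs every attempt probability to be at most 1: if u has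
-- a white neighbour w, the transposition of u and w maps N[u] ∩ B into N(u), so
-- |N[u] ∩ B| ≤ deg u.

open import Defs hiding (sym)
open import Algebra.Bundles using (Ring)
open import Data.Bool as Bool using (Bool; true; false; if_then_else_; _∧_; _∨_; not; T; T?)
open import Data.Bool.Properties using (≤-minimum; ≤-maximum; ∧-zeroʳ; T-∧; T-≡)
open import Data.Fin using (Fin; zero; suc)
open import Data.Fin.Permutation using (Permutation′; transpose; _⟨$⟩ʳ_)
open import Data.Fin.Properties using (_≟_)
import Data.Integer as ℤ
open import Data.Integer using (1ℤ)
open import Data.Integer.Solver as ℤ-Solver using ()
open import Data.List using (List; []; _∷_; map; _++_; filterᵇ; length; foldr; tabulate; allFin)
open import Data.List.Relation.Unary.All as All using (All; []; _∷_)
open import Data.List.Relation.Unary.All.Properties using (all-filter; map⁺)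
open import Data.Nat as ℕ using (ℕ; zero; suc; _≥_)
import Data.Nat.Properties as ℕ
open import Data.Product using (_×_; _,_; proj₂)
open import Data.Rational using (ℚ; 0ℚ; 1ℚ; _<_; _≤_; _+_; _*_; _-_; -_; toℚᵘ; NonNegative; nonNegative)
open import Data.Rational.Properties
  using ( toℚᵘ-injective; toℚᵘ-fromℚᵘ; toℚᵘ-homo-+; toℚᵘ-homo-*; normalize-nonNeg; normalize-pos
        ; nonNegative⁻¹; nonNeg*nonNeg⇒nonNeg; ≤-refl; ≤-reflexive; ≤-trans; <⇒≤; module ≤-Reasoning
        ; +-identityˡ; +-identityʳ; +-assoc; +-inverseʳ; *-identityˡ; *-identityʳ; *-zeroˡ; *-zeroʳ; *-assoc
        ; +-mono-≤; +-monoˡ-≤; +-monoʳ-≤; neg-antimono-≤; *-monoˡ-≤-nonNeg; *-monoʳ-≤-nonNeg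
        ; *-cancelˡ-≤-pos; +-*-ring )
open import Data.Rational.Solver as ℚ-Solver using ()
open import Data.Rational.Unnormalised as ℚᵘ using (mkℚᵘ; *≡*)
import Data.Rational.Unnormalised.Properties as ℚᵘ
open import Data.Vec using (Vec; []; _∷_; lookup)
open import Function using (_∘_)
open import Function.Bundles using (Equivalence)
open import Relation.Binary.PropositionalEquality
open import Relation.Nullary using (yes; no; contradiction)

open import Algebra.Properties.Semiring.Sum (Ring.semiring +-*-ring)

private variable
  X Y : Set

toℚᵘ-ℕtoℚ : ∀ n → toℚᵘ (ℕtoℚ n) ℚᵘ.≃ mkℚᵘ (ℤ.+ n) 0
toℚᵘ-ℕtoℚ n = toℚᵘ-fromℚᵘ (mkℚᵘ (ℤ.+ n) 0)

ℕtoℚ-+ : ∀ m n → ℕtoℚ (m ℕ.+ n) ≡ ℕtoℚ m + ℕtoℚ n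
ℕtoℚ-+ m n = toℚᵘ-injective (begin
  toℚᵘ (ℕtoℚ (m ℕ.+ n))                 ≈⟨ toℚᵘ-ℕtoℚ (m ℕ.+ n) ⟩
  mkℚᵘ (ℤ.+ (m ℕ.+ n)) 0                ≈⟨ *≡* (solve 2 (λ m n → (m :+ n) :* con 1ℤ := (m :* con 1ℤ :+ n :* con 1ℤ) :* con 1ℤ)
                                                      refl (ℤ.+ m) (ℤ.+ n)) ⟩
  mkℚᵘ (ℤ.+ m) 0 ℚᵘ.+ mkℚᵘ (ℤ.+ n) 0    ≈⟨ ℚᵘ.+-cong (toℚᵘ-ℕtoℚ m) (toℚᵘ-ℕtoℚ n) ⟨
  toℚᵘ (ℕtoℚ m) ℚᵘ.+ toℚᵘ (ℕtoℚ n)      ≈⟨ toℚᵘ-homo-+ (ℕtoℚ m) (ℕtoℚ n) ⟨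
  toℚᵘ (ℕtoℚ m + ℕtoℚ n)                ∎)
  where
  open ℚᵘ.≃-Reasoning
  open ℤ-Solver.+-*-Solver

-- The denominator of the ℚᵘ-product below computes to suc (d + 0), whence ℕ.+-identityʳ.
ℕtoℚ-*-ratio : ∀ k d → ℕtoℚ (suc d) * ratio k (suc d) ≡ ℕtoℚ k
ℕtoℚ-*-ratio k d = toℚᵘ-injective (begin
  toℚᵘ (ℕtoℚ (suc d) * ratio k (suc d))            ≈⟨ toℚᵘ-homo-* (ℕtoℚ (suc d)) (ratio k (suc d)) ⟩
  toℚᵘ (ℕtoℚ (suc d)) ℚᵘ.* toℚᵘ (ratio k (suc d))  ≈⟨ ℚᵘ.*-cong (toℚᵘ-ℕtoℚ (suc d)) (toℚᵘ-fromℚᵘ (mkℚᵘ (ℤ.+ k) d)) ⟩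
  mkℚᵘ (ℤ.+ suc d) 0 ℚᵘ.* mkℚᵘ (ℤ.+ k) d          ≈⟨ *≡* (trans (solve 2 (λ s k → (s :* k) :* con 1ℤ := k :* s) refl (ℤ.+ suc d) (ℤ.+ k))
                                                                 (cong (λ x → ℤ.+ k ℤ.* ℤ.+ suc x) (sym (ℕ.+-identityʳ d)))) ⟩
  mkℚᵘ (ℤ.+ k) 0                                   ≈⟨ toℚᵘ-ℕtoℚ k ⟨
  toℚᵘ (ℕtoℚ k)                                    ∎)
  where
  open ℚᵘ.≃-Reasoning
  open ℤ-Solver.+-*-Solver

ℕtoℚ-nonNeg : ∀ n → NonNegative (ℕtoℚ n)
ℕtoℚ-nonNeg n = normalize-nonNeg n 1

ratio-nonNeg : ∀ k d → NonNegative (ratio k d)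
ratio-nonNeg k zero    = _
ratio-nonNeg k (suc d) = normalize-nonNeg k (suc d)

ratio-≤-1 : ∀ k d → ℕtoℚ k ≤ ℕtoℚ d → ratio k d ≤ 1ℚ
ratio-≤-1 k zero    _   = nonNegative⁻¹ 1ℚ
ratio-≤-1 k (suc d) k≤d = *-cancelˡ-≤-pos (ℕtoℚ (suc d)) {{normalize-pos (suc d) 1}} (begin
  ℕtoℚ (suc d) * ratio k (suc d)  ≡⟨ ℕtoℚ-*-ratio k d ⟩
  ℕtoℚ k                          ≤⟨ k≤d ⟩
  ℕtoℚ (suc d)                    ≡⟨ *-identityʳ (ℕtoℚ (suc d)) ⟨
  ℕtoℚ (suc d) * 1ℚ               ∎)
  where open ≤-Reasoning

*-ratio-≤ : ∀ m k d → ℕtoℚ m ≤ ℕtoℚ d → ℕtoℚ m * ratio k d ≤ ℕtoℚ k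
*-ratio-≤ m k zero    _   = ≤-trans (≤-reflexive (*-zeroʳ (ℕtoℚ m))) (nonNegative⁻¹ (ℕtoℚ k) {{ℕtoℚ-nonNeg k}})
*-ratio-≤ m k (suc d) m≤d = begin
  ℕtoℚ m * ratio k (suc d)        ≤⟨ *-monoʳ-≤-nonNeg (ratio k (suc d)) {{ratio-nonNeg k (suc d)}} m≤d ⟩
  ℕtoℚ (suc d) * ratio k (suc d)  ≡⟨ ℕtoℚ-*-ratio k d ⟩
  ℕtoℚ k                          ∎
  where open ≤-Reasoning

0≤* : ∀ {p q} → 0ℚ ≤ p → 0ℚ ≤ q → 0ℚ ≤ p * q
0≤* {p} {q} 0≤p 0≤q = nonNegative⁻¹ (p * q) {{nonNeg*nonNeg⇒nonNeg p {{nonNegative 0≤p}} q {{nonNegative 0≤q}}}}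

p≤1⇒0≤1-p : ∀ {p} → p ≤ 1ℚ → 0ℚ ≤ 1ℚ - p
p≤1⇒0≤1-p {p} p≤1 = begin
  0ℚ      ≡⟨ +-inverseʳ p ⟨
  p - p   ≤⟨ +-monoˡ-≤ (- p) p≤1 ⟩
  1ℚ - p  ∎
  where open ≤-Reasoning

0≤p⇒1-p≤1 : ∀ {p} → 0ℚ ≤ p → 1ℚ - p ≤ 1ℚ
0≤p⇒1-p≤1 0≤p = +-monoʳ-≤ 1ℚ (neg-antimono-≤ 0≤p)

sum-mono-≤ : ∀ {n} {f g : Fin n → ℚ} → (∀ i → f i ≤ g i) → sum f ≤ sum g
sum-mono-≤ {zero}  f≤g = ≤-refl
sum-mono-≤ {suc n} f≤g = +-mono-≤ (f≤g zero) (sum-mono-≤ (f≤g ∘ suc))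

sum-nonNeg : ∀ {n} {f : Fin n → ℚ} → (∀ i → 0ℚ ≤ f i) → 0ℚ ≤ sum f
sum-nonNeg {n} 0≤f = ≤-trans (≤-reflexive (sym (sum-replicate-zero n))) (sum-mono-≤ 0≤f)

x∧y≤x : ∀ x y → x ∧ y Bool.≤ x
x∧y≤x true  y = ≤-maximum y
x∧y≤x false y = Bool.b≤b

x∧y≤y : ∀ x y → x ∧ y Bool.≤ y
x∧y≤y true  y = Bool.b≤b
x∧y≤y false y = ≤-minimum y

indicator : Bool → ℚ
indicator true  = 1ℚ
indicator false = 0ℚ

indicator-nonNeg : ∀ b → NonNegative (indicator b)
indicator-nonNeg true  = _
indicator-nonNeg false = _

indicator-mono : ∀ {a b} → a Bool.≤ b → indicator a ≤ indicator b
indicator-mono Bool.b≤b = ≤-refl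
indicator-mono Bool.f≤t = nonNegative⁻¹ 1ℚ

indicator-∧ : ∀ a b → indicator (a ∧ b) ≡ indicator a * indicator b
indicator-∧ true  b = sym (*-identityˡ (indicator b))
indicator-∧ false b = sym (*-zeroˡ (indicator b))

listSum : List ℚ → ℚ
listSum = foldr _+_ 0ℚ

module _ (P : X → Bool) where

  ℕtoℚ-length-filterᵇ-tabulate : ∀ {n} (g : Fin n → X) →
    ℕtoℚ (length (filterᵇ P (tabulate g))) ≡ sum (indicator ∘ P ∘ g)
  ℕtoℚ-length-filterᵇ-tabulate {zero}  g = refl
  ℕtoℚ-length-filterᵇ-tabulate {suc n} g with P (g zero)
  ... | true  = trans (ℕtoℚ-+ 1 (length (filterᵇ P (tabulate (g ∘ suc)))))
                      (cong (1ℚ +_) (ℕtoℚ-length-filterᵇ-tabulate (g ∘ suc)))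
  ... | false = trans (ℕtoℚ-length-filterᵇ-tabulate (g ∘ suc)) (sym (+-identityˡ _))

  listSum-map-filterᵇ-tabulate : ∀ {n} (h : X → ℚ) (g : Fin n → X) →
    listSum (map h (filterᵇ P (tabulate g))) ≡ sum (λ i → indicator (P (g i)) * h (g i))
  listSum-map-filterᵇ-tabulate {zero}  h g = refl
  listSum-map-filterᵇ-tabulate {suc n} h g with P (g zero)
  ... | true  = cong₂ _+_ (sym (*-identityˡ (h (g zero)))) (listSum-map-filterᵇ-tabulate h (g ∘ suc))
  ... | false = begin
    listSum (map h (filterᵇ P (tabulate (g ∘ suc))))  ≡⟨ listSum-map-filterᵇ-tabulate h (g ∘ suc) ⟩
    rest                                              ≡⟨ +-identityˡ rest ⟨
    0ℚ + rest                                         ≡⟨ cong (_+ rest) (*-zeroˡ (h (g zero))) ⟨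
    0ℚ * h (g zero) + rest                            ∎
    where
    open ≡-Reasoning
    rest = sum (λ i → indicator (P (g (suc i))) * h (g (suc i)))

ℕtoℚ-count : ∀ {n} (P : Fin n → Bool) → ℕtoℚ (count P) ≡ sum (indicator ∘ P)
ℕtoℚ-count P = ℕtoℚ-length-filterᵇ-tabulate P (λ i → i)

count-mono : ∀ {n} {P Q : Fin n → Bool} → (∀ i → P i Bool.≤ Q i) → ℕtoℚ (count P) ≤ ℕtoℚ (count Q)
count-mono {P = P} {Q} P≤Q = begin
  ℕtoℚ (count P)       ≡⟨ ℕtoℚ-count P ⟩
  sum (indicator ∘ P)  ≤⟨ sum-mono-≤ (indicator-mono ∘ P≤Q) ⟩
  sum (indicator ∘ Q)  ≡⟨ ℕtoℚ-count Q ⟨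
  ℕtoℚ (count Q)       ∎
  where open ≤-Reasoning

count-permute : ∀ {n} (P : Fin n → Bool) (π : Permutation′ n) → ℕtoℚ (count (P ∘ (π ⟨$⟩ʳ_))) ≡ ℕtoℚ (count P)
count-permute P π = begin
  ℕtoℚ (count (P ∘ (π ⟨$⟩ʳ_)))     ≡⟨ ℕtoℚ-count (P ∘ (π ⟨$⟩ʳ_)) ⟩
  sum (indicator ∘ P ∘ (π ⟨$⟩ʳ_))  ≡⟨ sum-permute (indicator ∘ P) π ⟨
  sum (indicator ∘ P)              ≡⟨ ℕtoℚ-count P ⟨
  ℕtoℚ (count P)                   ∎
  where open ≡-Reasoning

mass : Dist X → ℚ
mass d = expect d (λ _ → 1ℚ)

ℙ : Dist Bool → ℚ
ℙ d = expect d indicator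

expect-return : ∀ (x : X) f → expect (return x) f ≡ f x
expect-return x f = trans (+-identityʳ (1ℚ * f x)) (*-identityˡ (f x))

mass-return : ∀ (x : X) → mass (return x) ≡ 1ℚ
mass-return x = expect-return x (λ _ → 1ℚ)

expect-cong : ∀ (d : Dist X) {f g} → (∀ a → f a ≡ g a) → expect d f ≡ expect d g
expect-cong []            f≗g = refl
expect-cong ((a , p) ∷ d) f≗g = cong₂ (λ x y → p * x + y) (f≗g a) (expect-cong d f≗g)

expect-++ : ∀ (d e : Dist X) f → expect (d ++ e) f ≡ expect d f + expect e f
expect-++ []            e f = sym (+-identityˡ (expect e f))
expect-++ ((a , p) ∷ d) e f = trans (cong (p * f a +_) (expect-++ d e f)) (sym (+-assoc (p * f a) _ _))

expect-zero : ∀ (d : Dist X) → expect d (λ _ → 0ℚ) ≡ 0ℚ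
expect-zero []            = refl
expect-zero ((a , p) ∷ d) = trans (cong₂ _+_ (*-zeroʳ p) (expect-zero d)) (+-identityˡ 0ℚ)

expect-+ : ∀ (d : Dist X) f g → expect d (λ a → f a + g a) ≡ expect d f + expect d g
expect-+ []            f g = sym (+-identityˡ 0ℚ)
expect-+ ((a , p) ∷ d) f g = trans (cong (p * (f a + g a) +_) (expect-+ d f g))
  (solve 5 (λ p x y s t → p :* (x :+ y) :+ (s :+ t) := (p :* x :+ s) :+ (p :* y :+ t)) refl p (f a) (g a) _ _)
  where open ℚ-Solver.+-*-Solver

expect-*ˡ : ∀ (d : Dist X) c f → expect d (λ a → c * f a) ≡ c * expect d f
expect-*ˡ []            c f = sym (*-zeroʳ c)
expect-*ˡ ((a , p) ∷ d) c f = trans (cong (p * (c * f a) +_) (expect-*ˡ d c f))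
  (solve 4 (λ p c x s → p :* (c :* x) :+ c :* s := c :* (p :* x :+ s)) refl p c (f a) _)
  where open ℚ-Solver.+-*-Solver

expect-const : ∀ (d : Dist X) c → mass d ≡ 1ℚ → expect d (λ _ → c) ≡ c
expect-const d c mass≡1 = begin
  expect d (λ _ → c)       ≡⟨ expect-cong d (λ _ → *-identityʳ c) ⟨
  expect d (λ _ → c * 1ℚ)  ≡⟨ expect-*ˡ d c (λ _ → 1ℚ) ⟩
  c * mass d               ≡⟨ cong (c *_) mass≡1 ⟩
  c * 1ℚ                   ≡⟨ *-identityʳ c ⟩
  c                        ∎
  where open ≡-Reasoning

expect-sum : ∀ (d : Dist X) {n} (F : Fin n → X → ℚ) →
  expect d (λ a → sum (λ i → F i a)) ≡ sum (λ i → expect d (F i))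
expect-sum d {zero}  F = expect-zero d
expect-sum d {suc n} F = trans (expect-+ d (F zero) _) (cong (expect d (F zero) +_) (expect-sum d (F ∘ suc)))

expect->>= : ∀ (d : Dist X) (g : X → Dist Y) f → expect (d >>= g) f ≡ expect d (λ a → expect (g a) f)
expect->>= []            g f = refl
expect->>= ((a , p) ∷ d) g f = trans (expect-++ (map _ (g a)) (d >>= g) f)
  (cong₂ _+_ (expect-scale (g a)) (expect->>= d g f))
  where
  expect-scale : ∀ e → expect (map (λ { (b , q) → (b , p * q) }) e) f ≡ p * expect e f
  expect-scale []            = sym (*-zeroʳ p)
  expect-scale ((b , q) ∷ e) = trans (cong (p * q * f b +_) (expect-scale e))
    (solve 4 (λ p q x s → p :* q :* x :+ p :* s := p :* (q :* x :+ s)) refl p q (f b) _)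
    where open ℚ-Solver.+-*-Solver

expect->>=-return : ∀ (d : Dist X) (h : X → Y) f → expect (d >>= λ a → return (h a)) f ≡ expect d (f ∘ h)
expect->>=-return d h f = trans (expect->>= d (return ∘ h) f) (expect-cong d (λ a → expect-return (h a) f))

mass->>= : ∀ (d : Dist X) (g : X → Dist Y) → mass d ≡ 1ℚ → (∀ a → mass (g a) ≡ 1ℚ) → mass (d >>= g) ≡ 1ℚ
mass->>= d g mass-d mass-g = trans (expect->>= d g _) (trans (expect-cong d mass-g) mass-d)

expect-bernoulli : ∀ q f → expect (bernoulli q) f ≡ q * f true + (1ℚ - q) * f false
expect-bernoulli q f = cong (q * f true +_) (+-identityʳ ((1ℚ - q) * f false))

mass-bernoulli : ∀ q → mass (bernoulli q) ≡ 1ℚ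
mass-bernoulli q = trans (expect-bernoulli q (λ _ → 1ℚ))
  (solve 1 (λ q → q :* con 1ℚ :+ (con 1ℚ :- q) :* con 1ℚ := con 1ℚ) refl q)
  where open ℚ-Solver.+-*-Solver

IsProbability : ℚ → Set
IsProbability q = 0ℚ ≤ q × q ≤ 1ℚ

mass-anySuccess : ∀ qs → mass (anySuccess qs) ≡ 1ℚ
mass-anySuccess []       = mass-return false
mass-anySuccess (q ∷ qs) = mass->>= (bernoulli q) (λ s → anySuccess qs >>= λ t → return (s ∨ t)) (mass-bernoulli q)
  (λ s → mass->>= (anySuccess qs) (λ t → return (s ∨ t)) (mass-anySuccess qs) (λ t → mass-return (s ∨ t)))

ℙ-anySuccess-∷ : ∀ q qs → ℙ (anySuccess (q ∷ qs)) ≡ q + (1ℚ - q) * ℙ (anySuccess qs)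
ℙ-anySuccess-∷ q qs = begin
  ℙ (anySuccess (q ∷ qs))
    ≡⟨ expect->>= (bernoulli q) (λ s → anySuccess qs >>= λ t → return (s ∨ t)) indicator ⟩
  expect (bernoulli q) (λ s → expect (anySuccess qs >>= λ t → return (s ∨ t)) indicator)
    ≡⟨ expect-cong (bernoulli q) (λ s → expect->>=-return (anySuccess qs) (s ∨_) indicator) ⟩
  expect (bernoulli q) (λ s → expect (anySuccess qs) (λ t → indicator (s ∨ t)))
    ≡⟨ expect-bernoulli q (λ s → expect (anySuccess qs) (λ t → indicator (s ∨ t))) ⟩
  q * mass (anySuccess qs) + (1ℚ - q) * ℙ (anySuccess qs)
    ≡⟨ cong (_+ (1ℚ - q) * ℙ (anySuccess qs)) (trans (cong (q *_) (mass-anySuccess qs)) (*-identityʳ q)) ⟩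
  q + (1ℚ - q) * ℙ (anySuccess qs)
    ∎
  where open ≡-Reasoning

ℙ-anySuccess-nonNeg : ∀ {qs} → All IsProbability qs → 0ℚ ≤ ℙ (anySuccess qs)
ℙ-anySuccess-nonNeg []                          = ≤-refl
ℙ-anySuccess-nonNeg {q ∷ qs} ((0≤q , q≤1) ∷ ps) = begin
  0ℚ                                ≤⟨ +-mono-≤ 0≤q (0≤* (p≤1⇒0≤1-p q≤1) (ℙ-anySuccess-nonNeg ps)) ⟩
  q + (1ℚ - q) * ℙ (anySuccess qs)  ≡⟨ ℙ-anySuccess-∷ q qs ⟨
  ℙ (anySuccess (q ∷ qs))           ∎
  where open ≤-Reasoning

ℙ-anySuccess-≤-listSum : ∀ {qs} → All IsProbability qs → ℙ (anySuccess qs) ≤ listSum qs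
ℙ-anySuccess-≤-listSum []                        = ≤-refl
ℙ-anySuccess-≤-listSum {q ∷ qs} ((0≤q , _) ∷ ps) = begin
  ℙ (anySuccess (q ∷ qs))  ≡⟨ ℙ-anySuccess-∷ q qs ⟩
  q + (1ℚ - q) * P         ≤⟨ +-monoʳ-≤ q (*-monoʳ-≤-nonNeg P {{nonNegative (ℙ-anySuccess-nonNeg ps)}} (0≤p⇒1-p≤1 0≤q)) ⟩
  q + 1ℚ * P               ≡⟨ cong (q +_) (*-identityˡ P) ⟩
  q + P                    ≤⟨ +-monoʳ-≤ q (ℙ-anySuccess-≤-listSum ps) ⟩
  q + listSum qs           ∎
  where
  open ≤-Reasoning
  P = ℙ (anySuccess qs)

trueCount : ∀ {n} → Vec Bool n → ℚ
trueCount c = ℕtoℚ (count (lookup c))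

expect-independent-suc : ∀ {n} (f : Fin (suc n) → Dist Bool) F →
  expect (independent f) F ≡ expect (f zero) (λ x → expect (independent (f ∘ suc)) (F ∘ (x ∷_)))
expect-independent-suc f F = trans (expect->>= (f zero) _ F)
  (expect-cong (f zero) (λ x → expect->>=-return (independent (f ∘ suc)) (x ∷_) F))

mass-independent : ∀ {n} (f : Fin n → Dist Bool) → (∀ i → mass (f i) ≡ 1ℚ) → mass (independent f) ≡ 1ℚ
mass-independent {zero}  f _      = mass-return {X = Vec Bool 0} []
mass-independent {suc n} f mass-f = trans (expect-independent-suc f (λ _ → 1ℚ))
  (trans (expect-cong (f zero) (λ _ → mass-independent (f ∘ suc) (mass-f ∘ suc))) (mass-f zero))

expect-independent-lookup : ∀ {n} (f : Fin n → Dist Bool) → (∀ i → mass (f i) ≡ 1ℚ) →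
  ∀ i g → expect (independent f) (λ c → g (lookup c i)) ≡ expect (f i) g
expect-independent-lookup {suc n} f mass-f zero g = trans (expect-independent-suc f (λ c → g (lookup c zero)))
  (expect-cong (f zero) (λ x → expect-const (independent (f ∘ suc)) (g x) (mass-independent (f ∘ suc) (mass-f ∘ suc))))
expect-independent-lookup {suc n} f mass-f (suc i) g = trans (expect-independent-suc f (λ c → g (lookup c (suc i))))
  (trans (expect-const (f zero) (expect (independent (f ∘ suc)) (λ c → g (lookup c i))) (mass-f zero))
         (expect-independent-lookup (f ∘ suc) (mass-f ∘ suc) i g))

expect-trueCount-independent : ∀ {n} (f : Fin n → Dist Bool) → (∀ i → mass (f i) ≡ 1ℚ) →
  expect (independent f) trueCount ≡ sum (ℙ ∘ f)
expect-trueCount-independent f mass-f = begin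
  expect (independent f) trueCount
    ≡⟨ expect-cong (independent f) (ℕtoℚ-count ∘ lookup) ⟩
  expect (independent f) (λ c → sum (λ i → indicator (lookup c i)))
    ≡⟨ expect-sum (independent f) (λ i c → indicator (lookup c i)) ⟩
  sum (λ i → expect (independent f) (λ c → indicator (lookup c i)))
    ≡⟨ sum-cong-≗ (λ i → expect-independent-lookup f mass-f i indicator) ⟩
  sum (ℙ ∘ f)
    ∎
  where open ≡-Reasoning

reversion : ℚ → Bool → Dist Bool
reversion p b = if b then (bernoulli p >>= λ r → return (not r)) else return false

mass-reversion : ∀ p b → mass (reversion p b) ≡ 1ℚ
mass-reversion p true  = mass->>= (bernoulli p) (λ r → return (not r)) (mass-bernoulli p) (λ r → mass-return (not r))
mass-reversion p false = mass-return false

ℙ-reversion : ∀ p b → ℙ (reversion p b) ≡ (1ℚ - p) * indicator b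
ℙ-reversion p true  = trans (expect->>=-return (bernoulli p) not indicator)
  (trans (expect-bernoulli p (indicator ∘ not)) (trans (cong (_+ (1ℚ - p) * 1ℚ) (*-zeroʳ p)) (+-identityˡ ((1ℚ - p) * 1ℚ))))
ℙ-reversion p false = trans (expect-return false indicator) (sym (*-zeroʳ (1ℚ - p)))

expect-trueCount-phase2 : ∀ {n} p (c : Vec Bool n) → expect (phase2 p c) trueCount ≡ (1ℚ - p) * trueCount c
expect-trueCount-phase2 p c = begin
  expect (phase2 p c) trueCount                  ≡⟨ expect-trueCount-independent (reversion p ∘ lookup c) (mass-reversion p ∘ lookup c) ⟩
  sum (ℙ ∘ reversion p ∘ lookup c)               ≡⟨ sum-cong-≗ (ℙ-reversion p ∘ lookup c) ⟩
  sum (λ i → (1ℚ - p) * indicator (lookup c i))  ≡⟨ *-distribˡ-sum (1ℚ - p) (indicator ∘ lookup c) ⟨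
  (1ℚ - p) * sum (indicator ∘ lookup c)          ≡⟨ cong ((1ℚ - p) *_) (ℕtoℚ-count (lookup c)) ⟨
  (1ℚ - p) * trueCount c                         ∎
  where open ≡-Reasoning

expectedBlue≡[1-p]*expect-phase1 : ∀ {n} (G : Graph n) B p → expectedBlue G B p ≡ (1ℚ - p) * expect (phase1 G B) trueCount
expectedBlue≡[1-p]*expect-phase1 G B p = begin
  expectedBlue G B p                                         ≡⟨ expect->>= (phase1 G B) (phase2 p) trueCount ⟩
  expect (phase1 G B) (λ c → expect (phase2 p c) trueCount)  ≡⟨ expect-cong (phase1 G B) (expect-trueCount-phase2 p) ⟩
  expect (phase1 G B) (λ c → (1ℚ - p) * trueCount c)         ≡⟨ expect-*ˡ (phase1 G B) (1ℚ - p) trueCount ⟩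
  (1ℚ - p) * expect (phase1 G B) trueCount                   ∎
  where open ≡-Reasoning

module _ {n} (G : Graph n) (B : Fin n → Bool) where

  blueClosedNbrs-≤-deg : ∀ {u w} → Edge G u w → B w ≡ false → ℕtoℚ (blueClosedNbrs G B u) ≤ ℕtoℚ (deg G u)
  blueClosedNbrs-≤-deg {u} {w} uw Bw = begin
    ℕtoℚ (blueClosedNbrs G B u)                     ≤⟨ count-mono into-N⟨u⟩ ⟩
    ℕtoℚ (count (adj G u ∘ (transpose u w ⟨$⟩ʳ_)))  ≡⟨ count-permute (adj G u) (transpose u w) ⟩
    ℕtoℚ (deg G u)                                  ∎
    where
    open ≤-Reasoning
    into-N⟨u⟩ : ∀ v → closedNbr G u v ∧ B v Bool.≤ adj G u (transpose u w ⟨$⟩ʳ v)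
    into-N⟨u⟩ v with v ≟ u
    ... | yes refl rewrite uw = ≤-maximum _
    ... | no v≢u with v ≟ w
    ...   | yes refl rewrite Bw | ∧-zeroʳ (closedNbr G u w) = ≤-minimum _
    ...   | no v≢w with u ≟ v
    ...     | yes refl = contradiction refl v≢u
    ...     | no _     = x∧y≤x (adj G u v) (B v)

  forceProb-≤-1 : ∀ {u w} → Edge G u w → B w ≡ false → forceProb G B u ≤ 1ℚ
  forceProb-≤-1 {u} uw Bw = ratio-≤-1 (blueClosedNbrs G B u) (deg G u) (blueClosedNbrs-≤-deg uw Bw)

  whiteNbr : Fin n → Fin n → Bool
  whiteNbr u w = not (B w) ∧ adj G u w

  whiteNbrs-*-forceProb-≤ : ∀ u → ℕtoℚ (count (whiteNbr u)) * forceProb G B u ≤ ℕtoℚ (count B)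
  whiteNbrs-*-forceProb-≤ u = ≤-trans
    (*-ratio-≤ (count (whiteNbr u)) (blueClosedNbrs G B u) (deg G u)
               (count-mono (λ w → x∧y≤y (not (B w)) (adj G u w))))
    (count-mono (λ v → x∧y≤y (closedNbr G u v) (B v)))

  indicator-*-forceProb-nonNeg : ∀ b u → 0ℚ ≤ indicator b * forceProb G B u
  indicator-*-forceProb-nonNeg b u = 0≤* (nonNegative⁻¹ (indicator b) {{indicator-nonNeg b}})
                                         (nonNegative⁻¹ (forceProb G B u) {{ratio-nonNeg (blueClosedNbrs G B u) (deg G u)}})

  successProb : Fin n → Fin n → ℚ
  successProb u w = indicator (B u ∧ whiteNbr u w) * forceProb G B u

  phase1Marginal : Fin n → Dist Bool
  phase1Marginal w = if B w then return true
    else anySuccess (map (forceProb G B) (filterᵇ (λ u → B u ∧ adj G u w) (allFin n)))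

  mass-phase1Marginal : ∀ w → mass (phase1Marginal w) ≡ 1ℚ
  mass-phase1Marginal w with B w
  ... | true  = mass-return true
  ... | false = mass-anySuccess (map (forceProb G B) (filterᵇ (λ u → B u ∧ adj G u w) (allFin n)))

  -- The `with` also abstracts B w inside successProb, whence the unfolded sums below.
  ℙ-phase1Marginal-≤ : ∀ w → ℙ (phase1Marginal w) ≤ indicator (B w) + sum (λ u → successProb u w)
  ℙ-phase1Marginal-≤ w with B w in Bw
  ... | true  = begin
    ℙ (return true)                                             ≡⟨ expect-return true indicator ⟩
    1ℚ                                                          ≡⟨ +-identityʳ 1ℚ ⟨
    1ℚ + 0ℚ                                                     ≤⟨ +-monoʳ-≤ 1ℚ (sum-nonNeg (λ u → indicator-*-forceProb-nonNeg (B u ∧ false) u)) ⟩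
    1ℚ + sum (λ u → indicator (B u ∧ false) * forceProb G B u)  ∎
    where open ≤-Reasoning
  ... | false = begin
    ℙ (anySuccess (map (forceProb G B) (filterᵇ attempts (allFin n))))
      ≤⟨ ℙ-anySuccess-≤-listSum (map⁺ (All.map attemptProb (all-filter (T? ∘ attempts) (allFin n)))) ⟩
    listSum (map (forceProb G B) (filterᵇ attempts (allFin n)))
      ≡⟨ listSum-map-filterᵇ-tabulate attempts (forceProb G B) (λ u → u) ⟩
    sum (λ u → indicator (attempts u) * forceProb G B u)
      ≡⟨ +-identityˡ _ ⟨
    0ℚ + sum (λ u → indicator (attempts u) * forceProb G B u)
      ∎
    where
    open ≤-Reasoning
    attempts : Fin n → Bool
    attempts u = B u ∧ adj G u w
    attemptProb : ∀ {u} → T (attempts u) → IsProbability (forceProb G B u)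
    attemptProb {u} t = nonNegative⁻¹ (forceProb G B u) {{ratio-nonNeg (blueClosedNbrs G B u) (deg G u)}}
                      , forceProb-≤-1 (Equivalence.to T-≡ (proj₂ (Equivalence.to T-∧ t))) Bw

  sum-successProb-≤ : ∀ u → sum (successProb u) ≤ indicator (B u) * ℕtoℚ (count B)
  sum-successProb-≤ u = begin
    sum (λ w → indicator (B u ∧ whiteNbr u w) * q)
      ≡⟨ sum-cong-≗ (λ w → trans (cong (_* q) (indicator-∧ (B u) (whiteNbr u w))) (*-assoc (indicator (B u)) (indicator (whiteNbr u w)) q)) ⟩
    sum (λ w → indicator (B u) * (indicator (whiteNbr u w) * q))
      ≡⟨ *-distribˡ-sum (indicator (B u)) (λ w → indicator (whiteNbr u w) * q) ⟨
    indicator (B u) * sum (λ w → indicator (whiteNbr u w) * q)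
      ≡⟨ cong (indicator (B u) *_) (*-distribʳ-sum q (indicator ∘ whiteNbr u)) ⟨
    indicator (B u) * (sum (indicator ∘ whiteNbr u) * q)
      ≡⟨ cong (λ s → indicator (B u) * (s * q)) (ℕtoℚ-count (whiteNbr u)) ⟨
    indicator (B u) * (ℕtoℚ (count (whiteNbr u)) * q)
      ≤⟨ *-monoˡ-≤-nonNeg (indicator (B u)) {{indicator-nonNeg (B u)}} (whiteNbrs-*-forceProb-≤ u) ⟩
    indicator (B u) * ℕtoℚ (count B)
      ∎
    where
    open ≤-Reasoning
    q = forceProb G B u

  expect-trueCount-phase1-≤ : expect (phase1 G B) trueCount ≤ ℕtoℚ (count B) + ℕtoℚ (count B) * ℕtoℚ (count B)
  expect-trueCount-phase1-≤ = begin
    expect (phase1 G B) trueCount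
      ≡⟨ expect-trueCount-independent phase1Marginal mass-phase1Marginal ⟩
    sum (ℙ ∘ phase1Marginal)
      ≤⟨ sum-mono-≤ ℙ-phase1Marginal-≤ ⟩
    sum (λ w → indicator (B w) + sum (λ u → successProb u w))
      ≡⟨ ∑-distrib-+ (indicator ∘ B) (λ w → sum (λ u → successProb u w)) ⟩
    sum (indicator ∘ B) + sum (λ w → sum (λ u → successProb u w))
      ≡⟨ cong₂ _+_ (sym (ℕtoℚ-count B)) (∑-comm (λ w u → successProb u w)) ⟩
    b + sum (λ u → sum (successProb u))
      ≤⟨ +-monoʳ-≤ b (sum-mono-≤ sum-successProb-≤) ⟩
    b + sum (λ u → indicator (B u) * b)
      ≡⟨ cong (b +_) (*-distribʳ-sum b (indicator ∘ B)) ⟨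
    b + sum (indicator ∘ B) * b
      ≡⟨ cong (λ s → b + s * b) (ℕtoℚ-count B) ⟨
    b + b * b
      ∎
    where
    open ≤-Reasoning
    b = ℕtoℚ (count B)

proposition3p9 : (n : ℕ) (G : Graph n) → Connected G →
    (B : Fin n → Bool) → count B ≥ 1 →
    (p : ℚ) → 0ℚ < p → p < 1ℚ →
    expectedBlue G B p ≤ (1ℚ - p) * (ℕtoℚ (count B) + ℕtoℚ (count B) * ℕtoℚ (count B))
proposition3p9 n G _ B _ p _ p<1 = begin
  expectedBlue G B p
    ≡⟨ expectedBlue≡[1-p]*expect-phase1 G B p ⟩
  (1ℚ - p) * expect (phase1 G B) trueCount
    ≤⟨ *-monoˡ-≤-nonNeg (1ℚ - p) {{nonNegative (p≤1⇒0≤1-p (<⇒≤ p<1))}} (expect-trueCount-phase1-≤ G B) ⟩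
  (1ℚ - p) * (b + b * b)
    ∎
  where
  open ≤-Reasoning
  b = ℕtoℚ (count B)
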